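{- Let $R$ be a finite associative ring with unity in which every right ideal is principal. Then there is no non-unimodular vector $(a,b)\in{}^2\!R$ such that $R(a,b)$ is a free cyclic submodule of ${}^2\!R$.
   Context: ${}^2\!R$ denotes the left $R$-module $R\times R$ with $\alpha(a,b)=(\alpha a,\alpha b)$; $R(a,b)=\{(\alpha a,\alpha b):\alpha\in R\}$ is a free cyclic submodule if $(\alpha a,\alpha b)=(0,0)$ implies $\alpha=0$. $(a,b)$ is unimodular if $aR+bR=\{ax+by:x,y\in R\}=R$. A right ideal is principal if it equals $cR$ for some $c\in R$. -}

module Defs where

open import Level using (Level; _⊔_; suc)
open import Algebra.Bundles using (Ring)
open import Data.Nat using (ℕ)
open import Data.Fin using (Fin)
open import Data.Product using (Σ; ∃; _×_; _,_)
open import Relation.Binary.PropositionalEquality using (_≡_)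
open import Relation.Unary using (Pred)
open import Function.Bundles using (_⇔_)

module _ {c ℓ : Level} (R : Ring c ℓ) where
  open Ring R

  Finite : Set (c ⊔ ℓ)
  Finite = Σ ℕ λ n → Σ (Fin n → Carrier) λ f →
             (∀ i j → f i ≈ f j → i ≡ j) × (∀ x → ∃ λ i → f i ≈ x)

  record IsRightIdeal {p : Level} (I : Pred Carrier p) : Set (c ⊔ ℓ ⊔ p) where
    field
      resp    : ∀ {x y} → x ≈ y → I x → I y
      has-0   : I 0#
      +-closed : ∀ {x y} → I x → I y → I (x + y)
      -‿closed : ∀ {x} → I x → I (- x)
      *ʳ-closed : ∀ {x} (r : Carrier) → I x → I (x * r)

  IsPrincipal : {p : Level} → Pred Carrier p → Set (c ⊔ ℓ ⊔ p)
  IsPrincipal I = ∃ λ g → ∀ x → (I x ⇔ (∃ λ r → x ≈ g * r))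

  EveryRightIdealPrincipal : Set (suc (c ⊔ ℓ))
  EveryRightIdealPrincipal =
    (I : Pred Carrier (c ⊔ ℓ)) → IsRightIdeal I → IsPrincipal I

  Unimodular : Carrier → Carrier → Set (c ⊔ ℓ)
  Unimodular a b = ∀ z → ∃ λ x → ∃ λ y → a * x + b * y ≈ z

  FreeCyclic : Carrier → Carrier → Set (c ⊔ ℓ)
  FreeCyclic a b = ∀ α → α * a ≈ 0# → α * b ≈ 0# → α ≈ 0#

module Submission where

-- The right ideal aR + bR equals gR
-- for some g = a x₀ + b y₀.  Any α with α g = 0 kills a and b (both lie in
-- gR), so α = 0 by freeness: g has zero left annihilator, i.e. y ↦ y g is
-- injective.  In a finite ring an injective self-map is surjective, so
-- u g = 1 for some u, and in a finite ring a one-sided inverse is two-sided,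
-- so also g u = 1.  Then every z equals g (u z) ∈ aR + bR, so (a , b) is
-- unimodular after all.

open import Defs
open import Level using (Level; _⊔_)
open import Algebra.Bundles using (Ring)
open import Data.Product using (∃; _×_; _,_; proj₁; proj₂)
open import Relation.Nullary using (¬_; yes; no; contradiction)
open import Relation.Unary using (Pred)
open import Relation.Binary.PropositionalEquality using (_≡_; cong) renaming (sym to ≡-sym)
open import Function.Bundles using (Equivalence)
open import Function.Definitions using (Injective)
open import Data.Nat using (suc)
open import Data.Nat.Properties using (1+n≰n)
open import Data.Fin using (Fin; punchOut)
open import Data.Fin.Properties using (any?; _≟_; punchOut-injective; injective⇒≤)
import Algebra.Properties.Ring as RingProperties
import Algebra.Properties.CommutativeSemigroup as CommutativeSemigroupProperties
import Algebra.Properties.AbelianGroup as AbelianGroupProperties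
import Relation.Binary.Reasoning.Setoid as SetoidReasoning

-- Pigeonhole in the form "injective ⇒ surjective" for Fin n: if y were
-- missed by f, punching y out of the codomain would inject Fin (suc m) into
-- Fin m.
fin-injective⇒surjective : ∀ {n} (f : Fin n → Fin n) → Injective _≡_ _≡_ f →
                           ∀ y → ∃ λ i → f i ≡ y
fin-injective⇒surjective {suc m} f f-inj y with any? (λ i → f i ≟ y)
... | yes hit = hit
... | no miss = contradiction (injective⇒≤ squeeze-injective) 1+n≰n
  where
  y≢f : ∀ i → y ≡ f i → _
  y≢f i y≡fi = miss (i , ≡-sym y≡fi)

  squeeze : Fin (suc m) → Fin m
  squeeze i = punchOut (y≢f i)

  squeeze-injective : Injective _≡_ _≡_ squeeze
  squeeze-injective {i} {j} eq = f-inj (punchOut-injective (y≢f i) (y≢f j) eq)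

module _ {c ℓ : Level} (R : Ring c ℓ) where
  open Ring R
  open SetoidReasoning setoid
  open RingProperties R using ([y-z]x≈yx-zx; -‿distribʳ-*)
  open CommutativeSemigroupProperties +-commutativeSemigroup using (interchange)
  open AbelianGroupProperties +-abelianGroup using (⁻¹-∙-comm)

  -- On a finite ring, an injective self-map of the carrier is surjective:
  -- conjugate it by the enumeration to a self-map of Fin n.
  finite-injective⇒surjective : Finite R → (h : Carrier → Carrier) →
                                Injective _≈_ _≈_ h → ∀ z → ∃ λ x → h x ≈ z
  finite-injective⇒surjective (n , enum , enum-inj , index) h h-inj z =
    enum i , (begin
      h (enum i)        ≈⟨ sym (enum-index (h (enum i))) ⟩
      enum (h̃ i)        ≡⟨ cong enum h̃i≡z ⟩
      enum (index-of z) ≈⟨ enum-index z ⟩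
      z                 ∎)
    where
    index-of : Carrier → Fin n
    index-of x with index x
    ... | i , _ = i

    enum-index : ∀ x → enum (index-of x) ≈ x
    enum-index x with index x
    ... | _ , eq = eq

    h̃ : Fin n → Fin n
    h̃ i = index-of (h (enum i))

    h̃-injective : Injective _≡_ _≡_ h̃
    h̃-injective {i} {j} eq = enum-inj i j (h-inj (begin
      h (enum i)  ≈⟨ sym (enum-index (h (enum i))) ⟩
      enum (h̃ i)  ≡⟨ cong enum eq ⟩
      enum (h̃ j)  ≈⟨ enum-index (h (enum j)) ⟩
      h (enum j)  ∎))

    i : Fin n
    i = proj₁ (fin-injective⇒surjective h̃ h̃-injective (index-of z))

    h̃i≡z : h̃ i ≡ index-of z
    h̃i≡z = proj₂ (fin-injective⇒surjective h̃ h̃-injective (index-of z))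

  annihilates-multiples : ∀ α g r → α * g ≈ 0# → α * (g * r) ≈ 0#
  annihilates-multiples α g r αg≈0 = begin
    α * (g * r) ≈⟨ sym (*-assoc α g r) ⟩
    α * g * r   ≈⟨ *-congʳ αg≈0 ⟩
    0# * r      ≈⟨ zeroˡ r ⟩
    0#          ∎

  zero-annihilator⇒rightMul-injective : ∀ g → (∀ α → α * g ≈ 0# → α ≈ 0#) →
                                        Injective _≈_ _≈_ (_* g)
  zero-annihilator⇒rightMul-injective g ann {y} {z} yg≈zg = begin
    y             ≈⟨ sym (+-identityʳ y) ⟩
    y + 0#        ≈⟨ +-congˡ (sym (-‿inverseˡ z)) ⟩
    y + (- z + z) ≈⟨ sym (+-assoc y (- z) z) ⟩
    (y - z) + z   ≈⟨ +-congʳ (ann (y - z) [y-z]g≈0) ⟩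
    0# + z        ≈⟨ +-identityˡ z ⟩
    z             ∎
    where
    [y-z]g≈0 : (y - z) * g ≈ 0#
    [y-z]g≈0 = begin
      (y - z) * g   ≈⟨ [y-z]x≈yx-zx g y z ⟩
      y * g - z * g ≈⟨ +-congʳ yg≈zg ⟩
      z * g - z * g ≈⟨ -‿inverseʳ (z * g) ⟩
      0#            ∎

  -- In a finite ring a left inverse is also a right inverse: y ↦ y u is
  -- injective (undo it by ·g), so some v has v u = 1, and then
  -- v = v (u g) = (v u) g = g.
  finite-leftInverse⇒rightInverse : Finite R → ∀ {u g} → u * g ≈ 1# → g * u ≈ 1#
  finite-leftInverse⇒rightInverse fin {u} {g} ug≈1 = begin
    g * u ≈⟨ *-congʳ g≈v ⟩
    v * u ≈⟨ vu≈1 ⟩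
    1#    ∎
    where
    cancel-ug : ∀ y → y * u * g ≈ y
    cancel-ug y = begin
      y * u * g   ≈⟨ *-assoc y u g ⟩
      y * (u * g) ≈⟨ *-congˡ ug≈1 ⟩
      y * 1#      ≈⟨ *-identityʳ y ⟩
      y           ∎

    rightMul-u-injective : Injective _≈_ _≈_ (_* u)
    rightMul-u-injective {y} {z} yu≈zu = begin
      y         ≈⟨ sym (cancel-ug y) ⟩
      y * u * g ≈⟨ *-congʳ yu≈zu ⟩
      z * u * g ≈⟨ cancel-ug z ⟩
      z         ∎

    v : Carrier
    v = proj₁ (finite-injective⇒surjective fin (_* u) rightMul-u-injective 1#)

    vu≈1 : v * u ≈ 1#
    vu≈1 = proj₂ (finite-injective⇒surjective fin (_* u) rightMul-u-injective 1#)

    g≈v : g ≈ v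
    g≈v = begin
      g         ≈⟨ sym (*-identityˡ g) ⟩
      1# * g    ≈⟨ *-congʳ (sym vu≈1) ⟩
      v * u * g ≈⟨ cancel-ug v ⟩
      v         ∎

  Span : Carrier → Carrier → Pred Carrier (c ⊔ ℓ)
  Span a b z = ∃ λ x → ∃ λ y → a * x + b * y ≈ z

  span-isRightIdeal : ∀ a b → IsRightIdeal R (Span a b)
  span-isRightIdeal a b = record
    { resp      = λ { z≈z′ (x , y , eq) → x , y , trans eq z≈z′ }
    ; has-0     = 0# , 0# , trans (+-cong (zeroʳ a) (zeroʳ b)) (+-identityˡ 0#)
    ; +-closed  = λ { (x , y , eq) (x′ , y′ , eq′) → x + x′ , y + y′ , (begin
        a * (x + x′) + b * (y + y′)         ≈⟨ +-cong (distribˡ a x x′) (distribˡ b y y′) ⟩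
        (a * x + a * x′) + (b * y + b * y′) ≈⟨ interchange _ _ _ _ ⟩
        (a * x + b * y) + (a * x′ + b * y′) ≈⟨ +-cong eq eq′ ⟩
        _                                   ∎) }
    ; -‿closed  = λ { {z} (x , y , eq) → - x , - y , (begin
        a * (- x) + b * (- y) ≈⟨ +-cong (sym (-‿distribʳ-* a x)) (sym (-‿distribʳ-* b y)) ⟩
        - (a * x) + - (b * y) ≈⟨ ⁻¹-∙-comm _ _ ⟩
        - (a * x + b * y)     ≈⟨ -‿cong eq ⟩
        - z                   ∎) }
    ; *ʳ-closed = λ { {z} r (x , y , eq) → x * r , y * r , span-*ʳ r eq }
    }
    where
    span-*ʳ : ∀ {x y z} r → a * x + b * y ≈ z → a * (x * r) + b * (y * r) ≈ z * r
    span-*ʳ {x} {y} {z} r eq = begin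
      a * (x * r) + b * (y * r) ≈⟨ +-cong (sym (*-assoc a x r)) (sym (*-assoc b y r)) ⟩
      a * x * r + b * y * r     ≈⟨ sym (distribʳ r (a * x) (b * y)) ⟩
      (a * x + b * y) * r       ≈⟨ *-congʳ eq ⟩
      z * r                     ∎

  a∈Span : ∀ a b → Span a b a
  a∈Span a b = 1# , 0# , trans (+-cong (*-identityʳ a) (zeroʳ b)) (+-identityʳ a)

  b∈Span : ∀ a b → Span a b b
  b∈Span a b = 0# , 1# , trans (+-cong (zeroʳ a) (*-identityʳ b)) (+-identityˡ b)

  rightInvertible∈Span⇒unimodular : ∀ {a b g u} → Span a b g → g * u ≈ 1# →
                                    Unimodular R a b
  rightInvertible∈Span⇒unimodular {a} {b} {g} {u} g∈Span gu≈1 z =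
    resp gw≈z (*ʳ-closed (u * z) g∈Span)
    where
    open IsRightIdeal (span-isRightIdeal a b)

    gw≈z : g * (u * z) ≈ z
    gw≈z = begin
      g * (u * z) ≈⟨ sym (*-assoc g u z) ⟩
      g * u * z   ≈⟨ *-congʳ gu≈1 ⟩
      1# * z      ≈⟨ *-identityˡ z ⟩
      z           ∎

mainTheorem8 : {c ℓ : Level} (R : Ring c ℓ) → Finite R → EveryRightIdealPrincipal R →
    ¬ (∃ λ a → ∃ λ b → (¬ Unimodular R a b) × FreeCyclic R a b)
mainTheorem8 R fin principal (a , b , ¬unimodular , free)
  with principal (Span R a b) (span-isRightIdeal R a b)
... | g , generates = ¬unimodular (rightInvertible∈Span⇒unimodular R g∈Span gu≈1)
  where
  open Ring R
  open Equivalence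

  g∈Span : Span R a b g
  g∈Span = from (generates g) (1# , sym (*-identityʳ g))

  annihilator-zero : ∀ α → α * g ≈ 0# → α ≈ 0#
  annihilator-zero α αg≈0 with to (generates a) (a∈Span R a b) | to (generates b) (b∈Span R a b)
  ... | r , a≈gr | s , b≈gs = free α
    (trans (*-congˡ a≈gr) (annihilates-multiples R α g r αg≈0))
    (trans (*-congˡ b≈gs) (annihilates-multiples R α g s αg≈0))

  leftInverse : ∃ λ u → u * g ≈ 1#
  leftInverse = finite-injective⇒surjective R fin (_* g)
                  (zero-annihilator⇒rightMul-injective R g annihilator-zero) 1#

  gu≈1 : g * proj₁ leftInverse ≈ 1#
  gu≈1 = finite-leftInverse⇒rightInverse R fin (proj₂ leftInverse)
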